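{- Let $k\geq 1$ and let $s_i>1$, $t_i>1$ be integers for $1\leq i\leq k$. If $G$ is the threshold graph realized by the code $0^{s_1}1^{t_1}0^{s_2}1^{t_2}\cdots0^{s_k}1^{t_k}$, then $\beta(G)=\sum_{i=1}^{k}(s_i+t_i-2)$.
   Context: Threshold graph realized by a binary code $b=b_1b_2\cdots b_n$ (with $b_1=0$): start with a single vertex $v_1$; for $i\geq 2$ add a vertex $v_i$, which is added as an isolated vertex if $b_i=0$ and as a dominating vertex (adjacent to all previously added vertices) if $b_i=1$. Thus for $i<j$, $v_i\sim v_j$ iff $b_j=1$. The notation $0^{s}1^{t}$ means $s$ zeros followed by $t$ ones. For an ordered set $\mathcal{W}=\{w_1,\dots,w_k\}$ of vertices of a connected graph, the representation of a vertex $w$ is $(d(w,w_1),\dots,d(w,w_k))$; $\mathcal{W}$ is a resolving set if all vertices have distinct representations; the metric dimension $\beta(G)$ is the minimum cardinality of a resolving set. -}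

module Defs where

open import Data.Bool using (Bool; true; false; T; _∧_; _∨_)
open import Data.Nat using (ℕ; zero; suc; _+_; _∸_; _≤_; _<ᵇ_)
open import Data.Fin using (Fin; toℕ)
open import Data.Fin.Subset using (Subset; _∈_; ∣_∣)
open import Data.List using (List; []; _∷_; _++_; replicate; concatMap; length; lookup; map)
open import Data.Product using (_×_; _,_; proj₁; proj₂)
open import Function.Bundles using (_⇔_)
open import Relation.Binary.PropositionalEquality using (_≡_)

Graph : ℕ → Set
Graph n = Fin n → Fin n → Bool

-- Threshold graph of a binary code b (true = 1, false = 0), vertices
-- v_1..v_n indexed by Fin (length b): for i < j, v_i ~ v_j iff b_j = 1.
thresholdGraph : (b : List Bool) → Graph (length b)
thresholdGraph b i j =
  ((toℕ i <ᵇ toℕ j) ∧ lookup b j) ∨ ((toℕ j <ᵇ toℕ i) ∧ lookup b i)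

-- The code 0^{s_1} 1^{t_1} ... 0^{s_k} 1^{t_k}, blocks given as a list of (s_i , t_i).
blockCode : List (ℕ × ℕ) → List Bool
blockCode = concatMap (λ p → replicate (proj₁ p) false ++ replicate (proj₂ p) true)

data Walk {n : ℕ} (G : Graph n) : ℕ → Fin n → Fin n → Set where
  here : ∀ {u} → Walk G zero u u
  step : ∀ {m u w v} → T (G u w) → Walk G m w v → Walk G (suc m) u v

IsDist : ∀ {n} → Graph n → Fin n → Fin n → ℕ → Set
IsDist G u v d = Walk G d u v × (∀ m → Walk G m u v → d ≤ m)

Resolving : ∀ {n} → Graph n → Subset n → Set
Resolving {n} G W =
  ∀ (u v : Fin n) →
  (∀ (w : Fin n) → w ∈ W → ∀ (d : ℕ) → (IsDist G u w d ⇔ IsDist G v w d)) →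
  u ≡ v

MetricDim : ∀ {n} → Graph n → ℕ → Set
MetricDim {n} G m =
  (Data.Product.Σ (Subset n) λ W → Resolving G W × ∣ W ∣ ≡ m) ×
  (∀ (W : Subset n) → Resolving G W → m ≤ ∣ W ∣)

-- The last vertex of the code is 1, hence dominating, so distances are 0, 1 or 2
-- and d(u,w) is determined by whether u ~ w.  Two vertices in the same run of the
-- code have the same neighbours, so a resolving set misses at most one vertex of
-- each run, and each run has length s_i or t_i.  Conversely, all vertices but the
-- first of each run resolve G: if u < v are both outside, v starts a run, and its
-- predecessor w (not the first of its run, as runs have length at least 2) sees
-- u and v differently, because u ~ w iff b_w while v ~ w iff b_v ≠ b_w.
module Submission where

open import Defs
open import Data.Bool using (Bool; true; false; T)
open import Data.Bool.Properties using (∨-identityʳ; ¬-not; T-≡)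
import Data.Bool.Properties as Bool
open import Data.Nat using (ℕ; zero; suc; _+_; _∸_; _≤_; _<_; _<ᵇ_; z≤n; s≤s; s≤s⁻¹; z<s; s<s)
open import Data.Nat.Properties
  using (≤-refl; <-trans; <⇒≤; ≤-antisym; <⇒≢; <⇒≯; <⇒<ᵇ; <ᵇ⇒<; ≤∧≢⇒<; <-cmp; m≤n⇒m≤1+n; n≮0; +-assoc; +-suc)
open import Data.Nat.ListAction using (sum)
open import Data.Fin using (Fin; zero; suc; toℕ; _≟_)
open import Data.Fin.Properties using (toℕ-injective)
open import Data.Fin.Subset using (Subset; _∈_; _∉_; ∣_∣; inside; outside)
open import Data.Fin.Subset.Properties using (_∈?_; drop-there)
open import Data.Vec using ([]; _∷_; here; there)
open import Data.List using (List; []; _∷_; [_]; _++_; length; lookup; replicate; map)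
open import Data.List.Properties using (++-assoc; ++-identityʳ)
open import Data.List.Relation.Unary.All using (All; []; _∷_)
open import Data.List.Relation.Binary.Pointwise using ([]; _∷_)
open import Data.List.Relation.Binary.Suffix.Heterogeneous using (Suffix; here; there; _++ˢ_)
open import Data.List.Relation.Binary.Suffix.Heterogeneous.Properties using (replicate⁺)
open import Data.Product using (_×_; _,_; proj₁; proj₂; ∃-syntax)
import Data.Sum as Sum
open Sum using (_⊎_; inj₁; inj₂)
open import Function using (_∘_)
open import Function.Bundles using (_⇔_; mk⇔; Equivalence)
open import Relation.Binary.Definitions using (tri<; tri≈; tri>)
open import Relation.Binary.PropositionalEquality
  using (_≡_; _≢_; refl; sym; trans; cong; subst; module ≡-Reasoning)
open import Relation.Nullary using (¬_; does; yes; no; contradiction)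

SameRun : (b : List Bool) → Fin (length b) → Fin (length b) → Set
SameRun b i j = ∀ k → toℕ i ≤ toℕ k → toℕ k ≤ toℕ j → lookup b k ≡ lookup b i

sameRun-zero : ∀ {x l} → SameRun (x ∷ l) zero zero
sameRun-zero zero    _ _  = refl
sameRun-zero (suc k) _ ()

sameRun-suc : ∀ {x l i j} → SameRun l i j → SameRun (x ∷ l) (suc i) (suc j)
sameRun-suc run zero    ()   _
sameRun-suc run (suc k) i≤k k≤j = run k (s≤s⁻¹ i≤k) (s≤s⁻¹ k≤j)

sameRun-cons : ∀ {y l j} → SameRun (y ∷ l) zero j → SameRun (y ∷ y ∷ l) zero (suc j)
sameRun-cons run zero    _ _   = refl
sameRun-cons run (suc k) _ k≤j = run k z≤n (s≤s⁻¹ k≤j)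

-- The positions whose bit repeats the previous one, p standing before position 0.
repeatPositions : Bool → (l : List Bool) → Subset (length l)
repeatPositions p []      = []
repeatPositions p (y ∷ l) = does (p Bool.≟ y) ∷ repeatPositions y l

zero∈repeatPositions : ∀ {p y l} → p ≡ y → zero ∈ repeatPositions p (y ∷ l)
zero∈repeatPositions {p} refl with p Bool.≟ p
... | yes _   = here
... | no p≢p = contradiction refl p≢p

∣repeatPositions∣-replicate : ∀ y n r →
  ∣ repeatPositions y (replicate n y ++ r) ∣ ≡ n + ∣ repeatPositions y r ∣
∣repeatPositions∣-replicate y zero    r = refl
∣repeatPositions∣-replicate y (suc n) r with y Bool.≟ y
... | yes _   = cong suc (∣repeatPositions∣-replicate y n r)
... | no y≢y = contradiction refl y≢y

repeats : List Bool → ℕ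
repeats []      = 0
repeats (x ∷ l) = ∣ repeatPositions x l ∣

HitsRunPairs : (b : List Bool) → Subset (length b) → Set
HitsRunPairs b W = ∀ i j → toℕ i < toℕ j → SameRun b i j → i ∈ W ⊎ j ∈ W

hitsRunPairs-tail : ∀ {x l w W} → HitsRunPairs (x ∷ l) (w ∷ W) → HitsRunPairs l W
hitsRunPairs-tail hits i j i<j run =
  Sum.map drop-there drop-there (hits (suc i) (suc j) (s<s i<j) (sameRun-suc run))

-- When W misses the first position, the rest of that run lies in W, which is the
-- hypothesis of repeats<∣W∣.
repeats≤∣W∣ : ∀ l W → HitsRunPairs l W → repeats l ≤ ∣ W ∣
repeats<∣W∣ : ∀ x l W → HitsRunPairs (x ∷ l) W →
  (∀ j → SameRun (x ∷ l) zero j → j ∈ W) → repeats (x ∷ l) < ∣ W ∣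

repeats≤∣W∣ []          _            _    = z≤n
repeats≤∣W∣ (x ∷ [])    _            _    = z≤n
repeats≤∣W∣ (x ∷ y ∷ l) (inside ∷ W) hits with x Bool.≟ y
... | yes refl = s≤s (repeats≤∣W∣ (x ∷ l) W (hitsRunPairs-tail hits))
... | no _     = m≤n⇒m≤1+n (repeats≤∣W∣ (y ∷ l) W (hitsRunPairs-tail hits))
repeats≤∣W∣ (x ∷ y ∷ l) (outside ∷ W) hits with x Bool.≟ y
... | no _     = repeats≤∣W∣ (y ∷ l) W (hitsRunPairs-tail hits)
... | yes refl = repeats<∣W∣ x l W (hitsRunPairs-tail hits) initialRun⊆W
  where
  initialRun⊆W : ∀ j → SameRun (x ∷ l) zero j → j ∈ W
  initialRun⊆W j run with hits zero (suc j) z<s (sameRun-cons run)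
  ... | inj₁ ()
  ... | inj₂ sj∈W = drop-there sj∈W

repeats<∣W∣ x l       (outside ∷ W) _    initialRun⊆W =
  contradiction (initialRun⊆W zero sameRun-zero) λ ()
repeats<∣W∣ x []      (inside ∷ []) _    _            = s≤s z≤n
repeats<∣W∣ x (y ∷ l) (inside ∷ W)  hits initialRun⊆W with x Bool.≟ y
... | no _     = s≤s (repeats≤∣W∣ (y ∷ l) W (hitsRunPairs-tail hits))
... | yes refl = s≤s (repeats<∣W∣ x l W (hitsRunPairs-tail hits)
                   λ j run → drop-there (initialRun⊆W (suc j) (sameRun-cons run)))

-- Every run of p ∷ l, except possibly the first, has length at least 2.
data LongRuns : Bool → List Bool → Set where
  []     : ∀ {p} → LongRuns p []
  repeat : ∀ {p l} → LongRuns p l → LongRuns p (p ∷ l)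
  newRun : ∀ {p y l} → LongRuns y l → LongRuns p (y ∷ y ∷ l)

longRuns-replicate : ∀ {y r} n → LongRuns y r → LongRuns y (replicate n y ++ r)
longRuns-replicate zero    long = long
longRuns-replicate (suc n) long = repeat (longRuns-replicate n long)

∉repeatPositions : ∀ {p l} → LongRuns p l → ∀ v → v ∉ repeatPositions p l →
  (toℕ v ≡ 0 × lookup l v ≢ p) ⊎
  (∃[ w ] suc (toℕ w) ≡ toℕ v × w ∈ repeatPositions p l × lookup l w ≢ lookup l v)
∉repeatPositions (repeat long) zero v∉ = contradiction (zero∈repeatPositions refl) v∉
∉repeatPositions (repeat long) (suc v) v∉ with ∉repeatPositions long v (λ v∈ → v∉ (there v∈))
... | inj₁ (v≡0 , lv≢p)            = inj₂ (zero , cong suc (sym v≡0) , zero∈repeatPositions refl , lv≢p ∘ sym)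
... | inj₂ (w , w+1≡v , w∈ , lw≢lv) = inj₂ (suc w , cong suc w+1≡v , there w∈ , lw≢lv)
∉repeatPositions (newRun long) zero v∉ =
  inj₁ (refl , λ y≡p → v∉ (zero∈repeatPositions (sym y≡p)))
∉repeatPositions (newRun long) (suc zero) v∉ = contradiction (there (zero∈repeatPositions refl)) v∉
∉repeatPositions (newRun long) (suc (suc v)) v∉ with ∉repeatPositions long v (λ v∈ → v∉ (there (there v∈)))
... | inj₁ (v≡0 , lv≢y) =
  inj₂ (suc zero , cong (2 +_) (sym v≡0) , there (zero∈repeatPositions refl) , lv≢y ∘ sym)
... | inj₂ (w , w+1≡v , w∈ , lw≢lv) =
  inj₂ (suc (suc w) , cong (2 +_) w+1≡v , there (there w∈) , lw≢lv)

last-index : ∀ {A : Set} {x : A} {l} → Suffix _≡_ [ x ] l →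
  ∃[ c ] (∀ (j : Fin (length l)) → toℕ j ≤ toℕ c) × lookup l c ≡ x
last-index (here (refl ∷ [])) = zero , (λ { zero → z≤n }) , refl
last-index (there suffix) with last-index suffix
... | c , c-last , c≡x = suc c , (λ { zero → z≤n ; (suc j) → s≤s (c-last j) }) , c≡x

distinctDistance : Bool → ℕ
distinctDistance true  = 1
distinctDistance false = 2

distinctDistance-injective : ∀ {x y} → distinctDistance x ≡ distinctDistance y → x ≡ y
distinctDistance-injective {true}  {true}  _ = refl
distinctDistance-injective {false} {false} _ = refl

distinctDistance≢0 : ∀ x → distinctDistance x ≢ 0
distinctDistance≢0 true  ()
distinctDistance≢0 false ()

∉⇒≢ : ∀ {n} {W : Subset n} {u w} → u ∉ W → w ∈ W → u ≢ w
∉⇒≢ u∉W w∈W refl = u∉W w∈W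

module _ {n} (G : Graph n) where

  distance : Fin n → Fin n → ℕ
  distance u v with u ≟ v
  ... | yes _ = 0
  ... | no  _ = distinctDistance (G u v)

  distance-self : ∀ u → distance u u ≡ 0
  distance-self u with u ≟ u
  ... | yes _   = refl
  ... | no u≢u = contradiction refl u≢u

  distance-≢ : ∀ {u v} → u ≢ v → distance u v ≡ distinctDistance (G u v)
  distance-≢ {u} {v} u≢v with u ≟ v
  ... | yes u≡v = contradiction u≡v u≢v
  ... | no _    = refl

  equidistant⇔sameAdjacency : ∀ {u v w} → u ≢ w → v ≢ w →
    distance u w ≡ distance v w ⇔ G u w ≡ G v w
  equidistant⇔sameAdjacency u≢w v≢w = mk⇔
    (λ eq → distinctDistance-injective (trans (sym (distance-≢ u≢w)) (trans eq (distance-≢ v≢w))))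
    (λ eq → trans (distance-≢ u≢w) (trans (cong distinctDistance eq) (sym (distance-≢ v≢w))))

  DistanceResolving : Subset n → Set
  DistanceResolving W = ∀ u v → (∀ w → w ∈ W → distance u w ≡ distance v w) → u ≡ v

  equidistant-member : ∀ {W u v} → (∀ w → w ∈ W → distance u w ≡ distance v w) → u ∈ W → u ≡ v
  equidistant-member {u = u} {v} equi u∈W with u ≟ v
  ... | yes u≡v = u≡v
  ... | no u≢v  = contradiction
    (trans (sym (distance-≢ (u≢v ∘ sym))) (trans (sym (equi u u∈W)) (distance-self u)))
    (distinctDistance≢0 (G v u))

  twins-separated : ∀ {W i j} → DistanceResolving W → i ≢ j →
    (∀ w → w ≢ i → w ≢ j → G i w ≡ G j w) → i ∈ W ⊎ j ∈ W
  twins-separated {W} {i} {j} resolving i≢j twins with i ∈? W | j ∈? W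
  ... | yes i∈W | _       = inj₁ i∈W
  ... | no _    | yes j∈W = inj₂ j∈W
  ... | no i∉W  | no j∉W  = contradiction (resolving i j equidistant) i≢j
    where
    equidistant : ∀ w → w ∈ W → distance i w ≡ distance j w
    equidistant w w∈W = Equivalence.from (equidistant⇔sameAdjacency (∉⇒≢ i∉W w∈W) (∉⇒≢ j∉W w∈W))
      (twins w (∉⇒≢ i∉W w∈W ∘ sym) (∉⇒≢ j∉W w∈W ∘ sym))

  separated⇒not-equidistant : ∀ {W u v} → ∃[ w ] w ∈ W × G u w ≢ G v w → u ∉ W → v ∉ W →
    ¬ (∀ w → w ∈ W → distance u w ≡ distance v w)
  separated⇒not-equidistant (w , w∈W , adj≢) u∉W v∉W equi = adj≢ (Equivalence.to
    (equidistant⇔sameAdjacency (∉⇒≢ u∉W w∈W) (∉⇒≢ v∉W w∈W)) (equi w w∈W))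

  separated⇒distanceResolving : ∀ {W} →
    (∀ u v → toℕ u < toℕ v → u ∉ W → v ∉ W → ∃[ w ] w ∈ W × G u w ≢ G v w) →
    DistanceResolving W
  separated⇒distanceResolving {W} separated u v equi with u ∈? W | v ∈? W
  ... | yes u∈W | _       = equidistant-member equi u∈W
  ... | no _    | yes v∈W = sym (equidistant-member (λ w w∈W → sym (equi w w∈W)) v∈W)
  ... | no u∉W  | no v∉W  with <-cmp (toℕ u) (toℕ v)
  ...   | tri≈ _ u≡v _ = toℕ-injective u≡v
  ...   | tri< u<v _ _ = contradiction equi
          (separated⇒not-equidistant (separated u v u<v u∉W v∉W) u∉W v∉W)
  ...   | tri> _ _ v<u = contradiction (λ w w∈W → sym (equi w w∈W))
          (separated⇒not-equidistant (separated v u v<u v∉W u∉W) v∉W u∉W)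

walk-length≥1 : ∀ {n} {G : Graph n} {m u v} → u ≢ v → Walk G m u v → 1 ≤ m
walk-length≥1 u≢v here       = contradiction refl u≢v
walk-length≥1 u≢v (step _ _) = s≤s z≤n

walk-length≥2 : ∀ {n} {G : Graph n} {m u v} → u ≢ v → ¬ T (G u v) → Walk G m u v → 2 ≤ m
walk-length≥2 u≢v _   here                = contradiction refl u≢v
walk-length≥2 _   ¬uv (step uv here)      = contradiction uv ¬uv
walk-length≥2 _   _   (step _ (step _ _)) = s≤s (s≤s z≤n)

isDist-unique : ∀ {n} {G : Graph n} {u v d e} → IsDist G u v d → IsDist G u v e → d ≡ e
isDist-unique (walk-d , d-min) (walk-e , e-min) = ≤-antisym (d-min _ walk-e) (e-min _ walk-d)

module _ {n} {G : Graph n} {c : Fin n}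
         (dominating : ∀ v → v ≢ c → T (G v c) × T (G c v)) where

  isDist-nonadjacent : ∀ {u v} → u ≢ v → ¬ T (G u v) → IsDist G u v 2
  isDist-nonadjacent {u} {v} u≢v ¬uv =
    step (proj₁ (dominating u u≢c)) (step (proj₂ (dominating v v≢c)) here) ,
    λ _ → walk-length≥2 u≢v ¬uv
    where
    u≢c : u ≢ c
    u≢c refl = ¬uv (proj₂ (dominating v (u≢v ∘ sym)))
    v≢c : v ≢ c
    v≢c refl = ¬uv (proj₁ (dominating u u≢v))

  isDist-distance : ∀ u v → IsDist G u v (distance G u v)
  isDist-distance u v with u ≟ v
  ... | yes refl = here , λ _ _ → z≤n
  ... | no u≢v with G u v in uv
  ...   | true  = step (Equivalence.from T-≡ uv) here , λ _ → walk-length≥1 u≢v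
  ...   | false = isDist-nonadjacent u≢v (λ t → subst T uv t)

  isDist⇒≡distance : ∀ {u v d} → IsDist G u v d → d ≡ distance G u v
  isDist⇒≡distance p = isDist-unique p (isDist-distance _ _)

  resolving⇔distanceResolving : ∀ {W} → Resolving G W ⇔ DistanceResolving G W
  resolving⇔distanceResolving = mk⇔
    (λ resolving u v equi → resolving u v λ w w∈W d →
      mk⇔ (transfer (equi w w∈W)) (transfer (sym (equi w w∈W))))
    (λ resolving u v same → resolving u v λ w w∈W →
      isDist⇒≡distance (Equivalence.to (same w w∈W _) (isDist-distance u w)))
    where
    transfer : ∀ {x y w d} → distance G x w ≡ distance G y w → IsDist G x w d → IsDist G y w d
    transfer {y = y} {w} eq p = subst (IsDist G y w) (sym (trans (isDist⇒≡distance p) eq)) (isDist-distance y w)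

<ᵇ≡true : ∀ {m n} → m < n → (m <ᵇ n) ≡ true
<ᵇ≡true = Equivalence.to T-≡ ∘ <⇒<ᵇ

<ᵇ≡false : ∀ {m n} → ¬ m < n → (m <ᵇ n) ≡ false
<ᵇ≡false {m} {n} m≮n = ¬-not (m≮n ∘ <ᵇ⇒< m n ∘ Equivalence.from T-≡)

module _ (b : List Bool) where

  thresholdGraph-< : ∀ {i j} → toℕ i < toℕ j → thresholdGraph b i j ≡ lookup b j
  thresholdGraph-< {i} {j} i<j rewrite <ᵇ≡true i<j | <ᵇ≡false (<⇒≯ i<j) = ∨-identityʳ (lookup b j)

  thresholdGraph-> : ∀ {i j} → toℕ j < toℕ i → thresholdGraph b i j ≡ lookup b i
  thresholdGraph-> {i} {j} j<i rewrite <ᵇ≡true j<i | <ᵇ≡false (<⇒≯ j<i) = refl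

  last-dominating : ∀ {c} → (∀ j → toℕ j ≤ toℕ c) → lookup b c ≡ true →
    ∀ v → v ≢ c → T (thresholdGraph b v c) × T (thresholdGraph b c v)
  last-dominating {c} c-last c-true v v≢c =
    Equivalence.from T-≡ (trans (thresholdGraph-< v<c) c-true) ,
    Equivalence.from T-≡ (trans (thresholdGraph-> v<c) c-true)
    where
    v<c : toℕ v < toℕ c
    v<c = ≤∧≢⇒< (c-last v) (v≢c ∘ toℕ-injective)

  sameRun-twins : ∀ {i j} → toℕ i < toℕ j → SameRun b i j →
    ∀ w → w ≢ i → w ≢ j → thresholdGraph b i w ≡ thresholdGraph b j w
  sameRun-twins {i} {j} i<j run w w≢i w≢j with <-cmp (toℕ w) (toℕ i)
  ... | tri≈ _ w≡i _ = contradiction (toℕ-injective w≡i) w≢i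
  ... | tri< w<i _ _ =
    trans (thresholdGraph-> w<i) (sym (trans (thresholdGraph-> (<-trans w<i i<j)) (run j (<⇒≤ i<j) ≤-refl)))
  ... | tri> _ _ i<w with <-cmp (toℕ w) (toℕ j)
  ...   | tri≈ _ w≡j _ = contradiction (toℕ-injective w≡j) w≢j
  ...   | tri< w<j _ _ = trans (thresholdGraph-< i<w)
          (trans (run w (<⇒≤ i<w) (<⇒≤ w<j)) (sym (trans (thresholdGraph-> w<j) (run j (<⇒≤ i<j) ≤-refl))))
  ...   | tri> _ _ j<w = trans (thresholdGraph-< i<w) (sym (thresholdGraph-< j<w))

  repeatPositions-separated : ∀ {p} → LongRuns p b → ∀ u v → toℕ u < toℕ v →
    u ∉ repeatPositions p b → v ∉ repeatPositions p b →
    ∃[ w ] w ∈ repeatPositions p b × thresholdGraph b u w ≢ thresholdGraph b v w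
  repeatPositions-separated long u v u<v u∉ v∉ with ∉repeatPositions long v v∉
  ... | inj₁ (v≡0 , _) = contradiction (subst (toℕ u <_) v≡0 u<v) n≮0
  ... | inj₂ (w , w+1≡v , w∈ , bw≢bv) = w , w∈ , λ eq →
    bw≢bv (trans (sym (thresholdGraph-< u<w)) (trans eq (thresholdGraph-> w<v)))
    where
    w<v : toℕ w < toℕ v
    w<v = subst (toℕ w <_) w+1≡v ≤-refl
    u<w : toℕ u < toℕ w
    u<w = ≤∧≢⇒< (s≤s⁻¹ (subst (toℕ u <_) (sym w+1≡v) u<v)) (∉⇒≢ u∉ w∈ ∘ toℕ-injective)

metricDim-thresholdGraph : ∀ {l} → LongRuns true (false ∷ l) →
  ∃[ c ] (∀ (j : Fin (suc (length l))) → toℕ j ≤ toℕ c) × lookup (false ∷ l) c ≡ true →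
  MetricDim (thresholdGraph (false ∷ l)) ∣ repeatPositions false l ∣
metricDim-thresholdGraph {l} long (c , c-last , c-true) =
  (repeatPositions true b , Equivalence.from resolving⇔ S-resolving , refl) ,
  λ W W-resolving → repeats≤∣W∣ b W λ i j i<j run →
    twins-separated G (Equivalence.to resolving⇔ W-resolving) (<⇒≢ i<j ∘ cong toℕ) (sameRun-twins b i<j run)
  where
  b : List Bool
  b = false ∷ l
  G : Graph (length b)
  G = thresholdGraph b
  resolving⇔ : ∀ {W} → Resolving G W ⇔ DistanceResolving G W
  resolving⇔ = resolving⇔distanceResolving (last-dominating b c-last c-true)
  S-resolving : DistanceResolving G (repeatPositions true b)
  S-resolving = separated⇒distanceResolving G (repeatPositions-separated b long)

blockCode-longRuns : ∀ bs → All (λ p → 1 < proj₁ p × 1 < proj₂ p) bs → LongRuns true (blockCode bs)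
blockCode-longRuns [] [] = []
blockCode-longRuns ((suc (suc s) , suc (suc t)) ∷ bs) ((s≤s (s≤s _) , s≤s (s≤s _)) ∷ long)
  rewrite ++-assoc (replicate s false) (replicate (suc (suc t)) true) (blockCode bs) =
  newRun (longRuns-replicate s (newRun (longRuns-replicate t (blockCode-longRuns bs long))))

∣repeatPositions∣-blockCode : ∀ bs → All (λ p → 1 < proj₁ p × 1 < proj₂ p) bs →
  ∣ repeatPositions true (blockCode bs) ∣ ≡ sum (map (λ p → proj₁ p + proj₂ p ∸ 2) bs)
∣repeatPositions∣-blockCode [] [] = refl
∣repeatPositions∣-blockCode ((suc (suc s) , suc (suc t)) ∷ bs) ((s≤s (s≤s _) , s≤s (s≤s _)) ∷ long) = begin
  ∣ repeatPositions true ((replicate (suc (suc s)) false ++ replicate (suc (suc t)) true) ++ rest) ∣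
    ≡⟨ cong (λ c → ∣ repeatPositions true c ∣) (++-assoc (replicate (suc (suc s)) false) _ rest) ⟩
  ∣ repeatPositions false (replicate (suc s) false ++ replicate (suc (suc t)) true ++ rest) ∣
    ≡⟨ ∣repeatPositions∣-replicate false (suc s) _ ⟩
  suc s + ∣ repeatPositions true (replicate (suc t) true ++ rest) ∣
    ≡⟨ cong (suc s +_) (∣repeatPositions∣-replicate true (suc t) rest) ⟩
  suc s + (suc t + ∣ repeatPositions true rest ∣)
    ≡⟨ cong (λ m → suc s + (suc t + m)) (∣repeatPositions∣-blockCode bs long) ⟩
  suc s + (suc t + total)
    ≡⟨ sym (trans (+-assoc s (suc (suc t)) total) (+-suc s (suc (t + total)))) ⟩
  s + suc (suc t) + total ∎
  where
  open ≡-Reasoning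
  rest : List Bool
  rest = blockCode bs
  total : ℕ
  total = sum (map (λ p → proj₁ p + proj₂ p ∸ 2) bs)

blockCode-endsInTrue : ∀ bs → bs ≢ [] → All (λ p → 1 < proj₁ p × 1 < proj₂ p) bs →
  Suffix _≡_ [ true ] (blockCode bs)
blockCode-endsInTrue [] bs≢[] _ = contradiction refl bs≢[]
blockCode-endsInTrue ((s , t) ∷ []) _ ((_ , 1<t) ∷ [])
  rewrite ++-identityʳ (replicate s false ++ replicate t true) =
  replicate s false ++ˢ replicate⁺ (<⇒≤ 1<t) refl
blockCode-endsInTrue ((s , t) ∷ bs@(_ ∷ _)) _ (_ ∷ long) =
  (replicate s false ++ replicate t true) ++ˢ blockCode-endsInTrue bs (λ ()) long

theorem2p5 : (blocks : List (ℕ × ℕ)) → blocks ≢ [] →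
    All (λ p → 1 < proj₁ p × 1 < proj₂ p) blocks →
    MetricDim (thresholdGraph (blockCode blocks))
      (sum (map (λ p → proj₁ p + proj₂ p ∸ 2) blocks))
theorem2p5 [] bs≢[] _ = contradiction refl bs≢[]
theorem2p5 bs@((suc (suc _) , _) ∷ _) bs≢[] long@((s≤s (s≤s _) , _) ∷ _) =
  subst (MetricDim (thresholdGraph (blockCode bs))) (∣repeatPositions∣-blockCode bs long)
    (metricDim-thresholdGraph (blockCode-longRuns bs long)
      (last-index (blockCode-endsInTrue bs bs≢[] long)))
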